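{- In the setting described in the context, let $(S,V\setminus S)$ be an ideal cut of the DAG $G$ and let $C=\{\rho_i: v_i\in S\setminus\{s\}\}$ be the corresponding closed subset of the rotation poset $\Pi$. Then for every pair $bg$ occurring in some but not all stable matchings, the path $P_{bg}$ has an edge going from $S$ to $V\setminus S$ if and only if the stable matching generated by $C$ contains $bg$.
   Context: Stable matching: $n$ boys, $n$ girls, strict complete preferences; $M_0$ boy-optimal and $M_z$ boy-pessimal stable matchings. For stable $M$ and boy $b$, $s_M(b)$ is the first girl on $b$'s list who strictly prefers $b$ to her $M$-partner; $next_M(b)$ is her $M$-partner. A rotation exposed in $M$ is a cyclic list $(b_0g_0,\dots,b_{r-1}g_{r-1})$ of pairs of $M$ with $b_{i+1}=next_M(b_i)$ (mod $r$); eliminating it matches each $b_i$ to $g_{i+1}$; it moves $b_i$ from $g_i$ to $g_{i+1}$. Rotation $\rho'$ precedes $\rho$ if $\rho'$ is eliminated in every elimination sequence from $M_0$ to a stable matching exposing $\rho$ (rotation poset $\Pi$). Closed subsets of $\Pi$ correspond bijectively to stable matchings; the matching generated by closed $C$ is obtained from $M_0$ by eliminating the rotations of $C$ in topological order. For each $b,g$ there is at most one rotation moving $b$ to $g$ and at most one moving $b$ from $g$. The DAG $G$: a vertex $v_i$ per rotation $\rho_i$, edge $v_iv_j$ whenever $\rho_i$ precedes $\rho_j$; a source $s$ with edges to all $v_i$ with $\rho_i$ minimal; a sink $t$ with edges from all $v_i$ with $\rho_i$ maximal. For each pair $bg$ occurring in some but not all stable matchings, $P_{bg}$ is a directed path: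 if $bg\in M_0$, from $s$ to the vertex of the rotation moving $b$ away from $g$; if $bg\in M_z\setminus M_0$, from the vertex of the rotation moving $b$ to $g$ to $t$; if $bg\notin M_0\cup M_z$, from the vertex of the rotation moving $b$ to $g$ to that of the rotation moving $b$ from $g$. An ideal cut is a partition $(S,V\setminus S)$ with $s\in S$, $t\notin S$ and no edge of $G$ from $V\setminus S$ into $S$. -}

module Defs where

open import Data.Nat using (ℕ; zero; suc; _<_; _≤_)
open import Data.Fin using (Fin; zero; suc)
open import Data.Vec using (Vec; lookup)
open import Data.Maybe using (Maybe; just; nothing)
open import Data.Product using (Σ; ∃; _×_; _,_)
open import Data.Bool using (Bool; true; false)
open import Data.Sum using (_⊎_)
open import Data.Empty using (⊥)
open import Data.List using (List; []; _∷_)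
open import Data.List.Membership.Propositional using (_∈_)
open import Relation.Nullary using (¬_)
open import Relation.Binary.PropositionalEquality using (_≡_; _≢_)
open import Function.Definitions using (Injective)
open import Function.Bundles using (_⇔_)

-- cyclic successor on Fin (suc r):  i ↦ i+1 mod (r+1)
csuc : ∀ {r} → Fin (suc r) → Fin (suc r)
csuc {zero} zero = zero
csuc {suc r} zero = suc zero
csuc {suc r} (suc i) with csuc i
... | zero = zero
... | suc j = suc (suc j)

-- An instance: n boys and n girls (both Fin n).
-- bp b g : rank of girl g on boy b's list (smaller = more preferred);
-- gp g b : rank of boy b on girl g's list.  Strictness/completeness is the
-- injectivity hypothesis imposed in the statement.
-- M0, Mz : the boy-optimal / boy-pessimal stable matchings (as parameters,
-- characterised by hypotheses in the statement).
module Inst (n : ℕ) (bp gp : Fin n → Fin n → ℕ) (M0 Mz : Fin n → Fin n) where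

  Boy Girl : Set
  Boy = Fin n
  Girl = Fin n

  Matching : Set
  Matching = Boy → Girl

  IsMatching : Matching → Set
  IsMatching M = Injective _≡_ _≡_ M

  Stable : Matching → Set
  Stable M = IsMatching M ×
    (∀ b b' → bp b (M b') < bp b (M b) → ¬ (gp (M b') b < gp (M b') b'))

  BoyOptimal BoyPessimal : Matching → Set
  BoyOptimal M = ∀ M' → Stable M' → ∀ b → bp b (M b) ≤ bp b (M' b)
  BoyPessimal M = ∀ M' → Stable M' → ∀ b → bp b (M' b) ≤ bp b (M b)

  GPrefers : Matching → Girl → Boy → Set
  GPrefers M g b = ∀ b' → M b' ≡ g → gp g b < gp g b'

  IsS : Matching → Boy → Girl → Set
  IsS M b g = GPrefers M g b × (∀ g' → bp b g' < bp b g → ¬ GPrefers M g' b)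

  IsNext : Matching → Boy → Boy → Set
  IsNext M b b' = IsS M b (M b')

  -- A rotation, as an object, records for each boy either nothing or the pair
  -- (girl he is moved from , girl he is moved to).
  Rot : Set
  Rot = Vec (Maybe (Girl × Girl)) n

  ExposedIn : Matching → Rot → Set
  ExposedIn M ρ = Σ ℕ λ r → Σ (Fin (suc r) → Boy) λ bs →
    Injective _≡_ _≡_ bs ×
    (∀ i → IsNext M (bs i) (bs (csuc i))) ×
    (∀ i → lookup ρ (bs i) ≡ just (M (bs i) , M (bs (csuc i)))) ×
    (∀ b → (∀ i → bs i ≢ b) → lookup ρ b ≡ nothing)

  elim : Matching → Rot → Matching
  elim M ρ b with lookup ρ b
  ... | just (_ , g) = g
  ... | nothing = M b

  -- ElimSeq M ρs : M is obtained from M0 by eliminating the rotations in ρs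
  -- (listed most recent first), each exposed when it is eliminated.
  data ElimSeq : Matching → List Rot → Set where
    start : ElimSeq M0 []
    step : ∀ {M ρs ρ} → ElimSeq M ρs → Stable M → ExposedIn M ρ →
           ElimSeq (elim M ρ) (ρ ∷ ρs)

  IsRot : Rot → Set
  IsRot ρ = ∃ λ M → Stable M × ExposedIn M ρ

  Precedes : Rot → Rot → Set
  Precedes ρ' ρ = ∀ M ρs → ElimSeq M ρs → Stable M → ExposedIn M ρ → ρ' ∈ ρs

  Minimal Maximal : Rot → Set
  Minimal ρ = ∀ ρ' → IsRot ρ' → ¬ Precedes ρ' ρ
  Maximal ρ = ∀ ρ' → IsRot ρ' → ¬ Precedes ρ ρ'

  data Vtx : Set where
    src snk : Vtx
    rot : Rot → Vtx

  data Edge : Vtx → Vtx → Set where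
    rr : ∀ {ρ ρ'} → IsRot ρ → IsRot ρ' → Precedes ρ ρ' → Edge (rot ρ) (rot ρ')
    sr : ∀ {ρ} → IsRot ρ → Minimal ρ → Edge src (rot ρ)
    rt : ∀ {ρ} → IsRot ρ → Maximal ρ → Edge (rot ρ) snk

  data Path : Vtx → Vtx → Set where
    [] : ∀ {u} → Path u u
    _∷_ : ∀ {u w x} → Edge u w → Path w x → Path u x

  IdealCut : (Vtx → Bool) → Set
  IdealCut S = S src ≡ true × S snk ≡ false ×
    (∀ u w → Edge u w → S u ≡ false → S w ≡ false)

  HasCrossing : (S : Vtx → Bool) → ∀ {u w} → Path u w → Set
  HasCrossing S [] = ⊥
  HasCrossing S (_∷_ {u} {w} e p) = (S u ≡ true × S w ≡ false) ⊎ HasCrossing S p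

  GeneratedBy : (Rot → Set) → Matching → Set
  GeneratedBy C M = Σ (List Rot) λ ρs → ElimSeq M ρs × (∀ ρ → (ρ ∈ ρs) ⇔ C ρ)

  OccursSomeNotAll : Boy → Girl → Set
  OccursSomeNotAll b g = (∃ λ M → Stable M × M b ≡ g) × (∃ λ M → Stable M × M b ≢ g)

  MovesTo MovesFrom : Rot → Boy → Girl → Set
  MovesTo ρ b g = ∃ λ g' → lookup ρ b ≡ just (g' , g)
  MovesFrom ρ b g = ∃ λ g' → lookup ρ b ≡ just (g , g')

  -- PEnds b g u w : u and w are the prescribed endpoints of P_bg
  data PEnds (b : Boy) (g : Girl) : Vtx → Vtx → Set where
    inM0 : ∀ {ρ} → M0 b ≡ g → IsRot ρ → MovesFrom ρ b g → PEnds b g src (rot ρ)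
    inMz : ∀ {ρ} → M0 b ≢ g → Mz b ≡ g → IsRot ρ → MovesTo ρ b g →
           PEnds b g (rot ρ) snk
    inner : ∀ {ρ ρ'} → M0 b ≢ g → Mz b ≢ g → IsRot ρ → IsRot ρ' →
            MovesTo ρ b g → MovesFrom ρ' b g → PEnds b g (rot ρ) (rot ρ')

-- Since no edge of G leaves V ∖ S, a path crosses from S to V ∖ S exactly when it starts in S
-- and ends outside S.  The rotations in S are the ones eliminated on the way from M0 to M, and
-- b is matched to g in M exactly when the rotation moving b to g (if any) has been eliminated
-- and the one moving b away from g has not.  This relies on the uniqueness of these rotations,
-- which comes from the lattice structure: the join of two stable matchings (each boy takes the
-- worse of his two partners) is stable, so b weakly prefers s_M(b) to his partner in any
-- stable matching that is worse for him.  Hence two rotations moving b away from the same girl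
-- move him to the same girl, their successors coincide, and following the cycles they are equal.
module Submission where

open import Defs
open import Data.Nat using (ℕ; suc; _<_; _≤_; _≤?_; _<?_)
open import Data.Nat.Properties
  using (≤-refl; ≤-reflexive; ≤-trans; <-≤-trans; <⇒≤; ≤∧≢⇒<; ≮⇒≥; <⇒≱; ≤-antisym; ≤-total;
         <-irrefl)
open import Data.Fin using (Fin; zero; suc; fromℕ; inject₁; punchOut)
open import Data.Fin.Properties
  using (_≟_; any?; ≤fromℕ; 0≢1+n; suc-injective; punchOut-injective; injective⇒≤)
open import Data.Fin.Induction using (<-weakInduction; <-weakInduction-startingFrom)
open import Data.Fin.Relation.Unary.Top using (view; ‵fromℕ; ‵inject₁)
open import Data.Vec using (lookup)
open import Data.Vec.Properties using (tabulate∘lookup; tabulate-cong)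
open import Data.Maybe using (just; nothing)
open import Data.Maybe.Properties using (just-injective)
open import Data.Product using (∃; ∃₂; _×_; _,_; proj₁; proj₂; map₂; uncurry)
open import Data.List using (List; _∷_)
open import Data.List.Membership.Propositional using (_∈_; _∉_)
open import Data.List.Relation.Unary.Any using (here; there)
open import Data.Sum using (_⊎_; inj₁; inj₂)
open import Data.Bool using (Bool; true; false)
open import Data.Bool.Properties using (¬-not; not-¬)
open import Relation.Nullary using (¬_; Dec; yes; no; contradiction)
open import Relation.Binary.PropositionalEquality
open import Function.Base using (_∘_)
open import Function.Definitions using (Injective)
open import Function.Bundles using (_⇔_; mk⇔; Equivalence)
open import Function.Properties.Equivalence using () renaming (trans to ⇔-trans)

injective⇒surjective : ∀ {n} {f : Fin n → Fin n} → Injective _≡_ _≡_ f → ∀ y → ∃ λ x → f x ≡ y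
injective⇒surjective {suc m} {f} f-inj y with any? (λ x → f x ≟ y)
... | yes hit = hit
... | no miss = contradiction (injective⇒≤ punchOut∘f-injective) (<-irrefl refl)
  where
  avoids : ∀ x → y ≢ f x
  avoids x y≡fx = miss (x , sym y≡fx)
  punchOut∘f-injective : Injective _≡_ _≡_ (λ x → punchOut (avoids x))
  punchOut∘f-injective eq = f-inj (punchOut-injective (avoids _) (avoids _) eq)

csuc-inject₁ : ∀ {r} (i : Fin r) → csuc (inject₁ i) ≡ suc i
csuc-inject₁ {suc r} zero = refl
csuc-inject₁ {suc r} (suc i) rewrite csuc-inject₁ i = refl

csuc-fromℕ : ∀ r → csuc (fromℕ r) ≡ zero
csuc-fromℕ 0 = refl
csuc-fromℕ (suc r) rewrite csuc-fromℕ r = refl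

csuc-injective : ∀ {r} → Injective _≡_ _≡_ (csuc {r})
csuc-injective {r} {i} {j} eq with view i | view j
... | ‵fromℕ | ‵fromℕ = refl
... | ‵fromℕ | ‵inject₁ j′ =
  contradiction (trans (sym (csuc-fromℕ r)) (trans eq (csuc-inject₁ j′))) 0≢1+n
... | ‵inject₁ i′ | ‵fromℕ =
  contradiction (trans (sym (csuc-fromℕ r)) (trans (sym eq) (csuc-inject₁ i′))) 0≢1+n
... | ‵inject₁ i′ | ‵inject₁ j′ =
  cong inject₁ (suc-injective (trans (sym (csuc-inject₁ i′)) (trans eq (csuc-inject₁ j′))))

csuc-induction : ∀ {r} (P : Fin (suc r) → Set) → (∀ i → P i → P (csuc i)) →
                 ∀ {j} → P j → ∀ k → P k
csuc-induction {r} P propagate {j} Pj = <-weakInduction P P-zero advance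
  where
  advance : ∀ i → P (inject₁ i) → P (suc i)
  advance i = subst P (csuc-inject₁ i) ∘ propagate (inject₁ i)
  P-zero : P zero
  P-zero = subst P (csuc-fromℕ r)
    (propagate (fromℕ r) (<-weakInduction-startingFrom P Pj advance (≤fromℕ j)))

module Matchings (n : ℕ) (bp gp : Fin n → Fin n → ℕ)
  (bp-injective : ∀ b → Injective _≡_ _≡_ (bp b)) (gp-injective : ∀ g → Injective _≡_ _≡_ (gp g))
  (M0 Mz : Fin n → Fin n) where

  open Inst n bp gp M0 Mz

  bp-< : ∀ b {g g′} → bp b g ≤ bp b g′ → g ≢ g′ → bp b g < bp b g′
  bp-< b le ne = ≤∧≢⇒< le (ne ∘ bp-injective b)

  gp-< : ∀ g {b b′} → gp g b ≤ gp g b′ → b ≢ b′ → gp g b < gp g b′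
  gp-< g le ne = ≤∧≢⇒< le (ne ∘ gp-injective g)

  module _ {M : Matching} (M-stable : Stable M) where

    M-injective : Injective _≡_ _≡_ M
    M-injective = proj₁ M-stable

    no-blocking-pair : ∀ {b b′ g} → M b′ ≡ g → bp b g < bp b (M b) → ¬ (gp g b < gp g b′)
    no-blocking-pair refl = proj₂ M-stable _ _

    partner : Girl → Boy
    partner g = proj₁ (injective⇒surjective M-injective g)

    partner-matched : ∀ g → M (partner g) ≡ g
    partner-matched g = proj₂ (injective⇒surjective M-injective g)

    s-worse : ∀ {b h} → IsS M b h → bp b (M b) < bp b h
    s-worse {b} {h} (h-prefers-b , _) = bp-< b (≮⇒≥ blocking) Mb≢h
      where
      blocking : ¬ (bp b h < bp b (M b))
      blocking lt = no-blocking-pair (partner-matched h) lt (h-prefers-b _ (partner-matched h))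
      Mb≢h : M b ≢ h
      Mb≢h Mb≡h = <-irrefl refl (h-prefers-b b Mb≡h)

  Moved : Rot → Boy → Set
  Moved ρ b = ∃ λ p → lookup ρ b ≡ just p

  module Cycle (M : Matching) (ρ : Rot) (exposed : ExposedIn M ρ) where

    len : ℕ
    len = proj₁ exposed

    boy : Fin (suc len) → Boy
    boy = proj₁ (proj₂ exposed)

    boy-injective : Injective _≡_ _≡_ boy
    boy-injective = proj₁ (proj₂ (proj₂ exposed))

    boy-next : ∀ i → IsNext M (boy i) (boy (csuc i))
    boy-next = proj₁ (proj₂ (proj₂ (proj₂ exposed)))

    boy-moves : ∀ i → lookup ρ (boy i) ≡ just (M (boy i) , M (boy (csuc i)))
    boy-moves = proj₁ (proj₂ (proj₂ (proj₂ (proj₂ exposed))))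

    off-cycle : ∀ b → (∀ i → boy i ≢ b) → lookup ρ b ≡ nothing
    off-cycle = proj₂ (proj₂ (proj₂ (proj₂ (proj₂ exposed))))

    on-cycle : ∀ {b p} → lookup ρ b ≡ just p → ∃ λ i → boy i ≡ b
    on-cycle {b} moved with any? (λ i → boy i ≟ b)
    ... | yes found = found
    ... | no missing with trans (sym moved) (off-cycle b (λ i eq → missing (i , eq)))
    ... | ()

    moves-from-partner-to-s : ∀ {b a c} → lookup ρ b ≡ just (a , c) → a ≡ M b × IsS M b c
    moves-from-partner-to-s moved with on-cycle moved
    ... | i , refl with just-injective (trans (sym moved) (boy-moves i))
    ... | refl = refl , boy-next i

    successor : ∀ {b a c} → lookup ρ b ≡ just (a , c) → ∃₂ λ b′ c′ → lookup ρ b′ ≡ just (c , c′)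
    successor moved with on-cycle moved
    ... | i , refl with just-injective (trans (sym moved) (boy-moves i))
    ... | refl = boy (csuc i) , _ , boy-moves (csuc i)

    around-cycle : (P : Boy → Set) → (∀ i → P (boy i) → P (boy (csuc i))) →
                   ∀ {x y} → Moved ρ x → P x → Moved ρ y → P y
    around-cycle P propagate (_ , x-moved) Px (_ , y-moved) with on-cycle x-moved | on-cycle y-moved
    ... | i , refl | j , refl = csuc-induction (P ∘ boy) propagate Px j

  moved-or-fixed : (ρ : Rot) (b : Boy) → (∃₂ λ a c → lookup ρ b ≡ just (a , c)) ⊎ lookup ρ b ≡ nothing
  moved-or-fixed ρ b with lookup ρ b
  ... | just (a , c) = inj₁ (a , c , refl)
  ... | nothing = inj₂ refl

  elim-moved : ∀ M ρ b {a c} → lookup ρ b ≡ just (a , c) → elim M ρ b ≡ c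
  elim-moved M ρ b moved rewrite moved = refl

  elim-fixed : ∀ M ρ b → lookup ρ b ≡ nothing → elim M ρ b ≡ M b
  elim-fixed M ρ b fixed rewrite fixed = refl

  module Elimination (M : Matching) (ρ : Rot) (M-stable : Stable M) (exposed : ExposedIn M ρ) where
    open Cycle M ρ exposed

    elim-boy : ∀ i → elim M ρ (boy i) ≡ M (boy (csuc i))
    elim-boy i = elim-moved M ρ (boy i) (boy-moves i)

    moved≢fixed : ∀ {x y p} → lookup ρ x ≡ just p → lookup ρ y ≡ nothing → elim M ρ x ≢ elim M ρ y
    moved≢fixed {y = y} x-moves y-fixed eq with on-cycle x-moves
    ... | i , refl
      with M-injective M-stable {boy (csuc i)} {y} (trans (sym (elim-boy i)) (trans eq (elim-fixed M ρ y y-fixed)))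
    ... | refl with trans (sym y-fixed) (boy-moves (csuc i))
    ... | ()

    elim-injective : Injective _≡_ _≡_ (elim M ρ)
    elim-injective {x} {y} eq with moved-or-fixed ρ x | moved-or-fixed ρ y
    ... | inj₂ x-fixed | inj₂ y-fixed =
      M-injective M-stable (trans (sym (elim-fixed M ρ x x-fixed)) (trans eq (elim-fixed M ρ y y-fixed)))
    ... | inj₁ (_ , _ , x-moves) | inj₂ y-fixed = contradiction eq (moved≢fixed x-moves y-fixed)
    ... | inj₂ x-fixed | inj₁ (_ , _ , y-moves) = contradiction (sym eq) (moved≢fixed y-moves x-fixed)
    ... | inj₁ (_ , _ , x-moves) | inj₁ (_ , _ , y-moves) with on-cycle x-moves | on-cycle y-moves
    ... | i , refl | j , refl = cong boy (csuc-injective (boy-injective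
          (M-injective M-stable (trans (sym (elim-boy i)) (trans eq (elim-boy j))))))

    girl-improves : ∀ {b b′} → M b′ ≡ elim M ρ b → gp (elim M ρ b) b ≤ gp (elim M ρ b) b′
    girl-improves {b} {b′} Mb′≡g with moved-or-fixed ρ b
    ... | inj₂ b-fixed = ≤-reflexive (cong (gp _)
          (M-injective M-stable (trans (sym (elim-fixed M ρ b b-fixed)) (sym Mb′≡g))))
    ... | inj₁ (_ , _ , b-moves) with on-cycle b-moves
    ... | i , refl = subst (λ g → M b′ ≡ g → gp g (boy i) ≤ gp g b′) (sym (elim-boy i))
                       (λ Mb′≡h → <⇒≤ (proj₁ (boy-next i) b′ Mb′≡h)) Mb′≡g

    elim-stable : Stable (elim M ρ)
    elim-stable = elim-injective , no-blocking
      where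
      no-blocking : ∀ b b′ → bp b (elim M ρ b′) < bp b (elim M ρ b) →
                    ¬ (gp (elim M ρ b′) b < gp (elim M ρ b′) b′)
      no-blocking b b′ b-prefers g-prefers with moved-or-fixed ρ b
      ... | inj₂ b-fixed =
        no-blocking-pair M-stable (partner-matched M-stable _)
          (subst (λ h → bp b (elim M ρ b′) < bp b h) (elim-fixed M ρ b b-fixed) b-prefers)
          (<-≤-trans g-prefers (girl-improves (partner-matched M-stable _)))
      ... | inj₁ (_ , _ , b-moves) =
        proj₂ (proj₂ (moves-from-partner-to-s b-moves)) (elim M ρ b′)
          (subst (λ h → bp b (elim M ρ b′) < bp b h) (elim-moved M ρ b b-moves) b-prefers)
          (λ _ Mx≡g → <-≤-trans g-prefers (girl-improves Mx≡g))

  Dominates : Matching → Matching → Set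
  Dominates M M′ = ∀ b → bp b (M b) ≤ bp b (M′ b)

  join : Matching → Matching → Matching
  join M₁ M₂ b with bp b (M₁ b) ≤? bp b (M₂ b)
  ... | yes _ = M₂ b
  ... | no _  = M₁ b

  join-≤ : ∀ M₁ M₂ b → bp b (M₁ b) ≤ bp b (M₂ b) → join M₁ M₂ b ≡ M₂ b
  join-≤ M₁ M₂ b le with bp b (M₁ b) ≤? bp b (M₂ b)
  ... | yes _ = refl
  ... | no ≰ = contradiction le ≰

  join-≥ : ∀ M₁ M₂ b → bp b (M₂ b) ≤ bp b (M₁ b) → join M₁ M₂ b ≡ M₁ b
  join-≥ M₁ M₂ b ge with bp b (M₁ b) ≤? bp b (M₂ b)
  ... | yes le = bp-injective b (≤-antisym ge le)
  ... | no _ = refl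

  join-cases : ∀ M₁ M₂ b → (join M₁ M₂ b ≡ M₂ b × bp b (M₁ b) ≤ bp b (M₂ b)) ⊎
                           (join M₁ M₂ b ≡ M₁ b × bp b (M₂ b) ≤ bp b (M₁ b))
  join-cases M₁ M₂ b with ≤-total (bp b (M₁ b)) (bp b (M₂ b))
  ... | inj₁ le = inj₁ (join-≤ M₁ M₂ b le , le)
  ... | inj₂ ge = inj₂ (join-≥ M₁ M₂ b ge , ge)

  join-comm : ∀ M₁ M₂ b → join M₁ M₂ b ≡ join M₂ M₁ b
  join-comm M₁ M₂ b with ≤-total (bp b (M₁ b)) (bp b (M₂ b))
  ... | inj₁ le = trans (join-≤ M₁ M₂ b le) (sym (join-≥ M₂ M₁ b le))
  ... | inj₂ ge = trans (join-≥ M₁ M₂ b ge) (sym (join-≤ M₂ M₁ b ge))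

  join-dominatesˡ : ∀ M₁ M₂ → Dominates M₁ (join M₁ M₂)
  join-dominatesˡ M₁ M₂ b with join-cases M₁ M₂ b
  ... | inj₁ (J≡M₂ , le) = subst (λ g → bp b (M₁ b) ≤ bp b g) (sym J≡M₂) le
  ... | inj₂ (J≡M₁ , _) = ≤-reflexive (cong (bp b) (sym J≡M₁))

  join-dominatesʳ : ∀ M₁ M₂ → Dominates M₂ (join M₁ M₂)
  join-dominatesʳ M₁ M₂ b =
    subst (λ g → bp b (M₂ b) ≤ bp b g) (join-comm M₂ M₁ b) (join-dominatesˡ M₂ M₁ b)

  module Join {M₁ M₂ : Matching} (M₁-stable : Stable M₁) (M₂-stable : Stable M₂) where

    Prefers₁ : Boy → Set
    Prefers₁ w = bp w (M₁ w) < bp w (M₂ w)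

    prefers₁-closed : ∀ {w z} → Prefers₁ w → M₂ z ≡ M₁ w → Prefers₁ z
    prefers₁-closed {w} {z} w-prefers M₂z≡M₁w = bp-< z (≮⇒≥ z-blocks-M₁) M₁z≢M₂z
      where
      z≢w : z ≢ w
      z≢w refl = <-irrefl (cong (bp w) (sym M₂z≡M₁w)) w-prefers
      M₁z≢M₂z : M₁ z ≢ M₂ z
      M₁z≢M₂z eq = z≢w (M-injective M₁-stable (trans eq M₂z≡M₁w))
      girl-prefers-z : gp (M₁ w) z < gp (M₁ w) w
      girl-prefers-z = gp-< (M₁ w) (≮⇒≥ (no-blocking-pair M₂-stable M₂z≡M₁w w-prefers)) z≢w
      z-blocks-M₁ : ¬ (bp z (M₂ z) < bp z (M₁ z))
      z-blocks-M₁ lt = no-blocking-pair M₁-stable refl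
        (subst (λ g → bp z g < bp z (M₁ z)) M₂z≡M₁w lt) girl-prefers-z

    -- M₂⁻¹ ∘ M₁ maps Prefers₁ injectively into itself; extended by the identity it is onto.
    shift : (w : Boy) → Dec (Prefers₁ w) → Boy
    shift w (yes _) = partner M₂-stable (M₁ w)
    shift w (no _)  = w

    shift-prefers₁ : ∀ w (d : Dec (Prefers₁ w)) → Prefers₁ w → Prefers₁ (shift w d)
    shift-prefers₁ w (yes _) w-prefers = prefers₁-closed w-prefers (partner-matched M₂-stable (M₁ w))
    shift-prefers₁ w (no ¬prefers) w-prefers = contradiction w-prefers ¬prefers

    shift-injective : ∀ v w (dv : Dec (Prefers₁ v)) (dw : Dec (Prefers₁ w)) →
                      shift v dv ≡ shift w dw → v ≡ w
    shift-injective v w (yes _) (yes _) eq = M-injective M₁-stable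
      (trans (sym (partner-matched M₂-stable (M₁ v))) (trans (cong M₂ eq) (partner-matched M₂-stable (M₁ w))))
    shift-injective v w (yes pv) (no ¬pw) eq =
      contradiction (subst Prefers₁ eq (shift-prefers₁ v (yes pv) pv)) ¬pw
    shift-injective v w (no ¬pv) (yes pw) eq =
      contradiction (subst Prefers₁ (sym eq) (shift-prefers₁ w (yes pw) pw)) ¬pv
    shift-injective v w (no _) (no _) eq = eq

    prefers₁? : ∀ w → Dec (Prefers₁ w)
    prefers₁? w = bp w (M₁ w) <? bp w (M₂ w)

    shift-all-injective : Injective _≡_ _≡_ (λ w → shift w (prefers₁? w))
    shift-all-injective {v} {w} = shift-injective v w (prefers₁? v) (prefers₁? w)

    prefers₁-preimage : ∀ {x} → Prefers₁ x → ∃ λ w → Prefers₁ w × M₂ x ≡ M₁ w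
    prefers₁-preimage {x} x-prefers with injective⇒surjective shift-all-injective x
    ... | w , shifted = preimage (prefers₁? w) shifted
      where
      preimage : (d : Dec (Prefers₁ w)) → shift w d ≡ x → ∃ λ w′ → Prefers₁ w′ × M₂ x ≡ M₁ w′
      preimage (yes w-prefers) refl = w , w-prefers , partner-matched M₂-stable (M₁ w)
      preimage (no ¬prefers) refl = contradiction x-prefers ¬prefers

    no-crossing : ∀ {x y} → bp x (M₁ x) ≤ bp x (M₂ x) → bp y (M₂ y) ≤ bp y (M₁ y) →
                  M₂ x ≡ M₁ y → x ≡ y
    no-crossing {x} {y} x-le y-ge M₂x≡M₁y with M₁ x ≟ M₂ x
    ... | yes M₁x≡M₂x = M-injective M₁-stable (trans M₁x≡M₂x M₂x≡M₁y)
    ... | no M₁x≢M₂x with prefers₁-preimage (bp-< x x-le M₁x≢M₂x)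
    ... | w , w-prefers , M₂x≡M₁w with M-injective M₁-stable {w} {y} (trans (sym M₂x≡M₁w) M₂x≡M₁y)
    ... | refl = contradiction y-ge (<⇒≱ w-prefers)

    join-injective : Injective _≡_ _≡_ (join M₁ M₂)
    join-injective {x} {y} eq with join-cases M₁ M₂ x | join-cases M₁ M₂ y
    ... | inj₁ (x₂ , _) | inj₁ (y₂ , _) = M-injective M₂-stable (trans (sym x₂) (trans eq y₂))
    ... | inj₂ (x₁ , _) | inj₂ (y₁ , _) = M-injective M₁-stable (trans (sym x₁) (trans eq y₁))
    ... | inj₁ (x₂ , x-le) | inj₂ (y₁ , y-ge) = no-crossing x-le y-ge (trans (sym x₂) (trans eq y₁))
    ... | inj₂ (x₁ , x-ge) | inj₁ (y₂ , y-le) = sym (no-crossing y-le x-ge (trans (sym y₂) (trans (sym eq) x₁)))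

    girl-gets-better : ∀ {b y g} → join M₁ M₂ b ≡ g → M₁ y ≡ g → gp g b ≤ gp g y
    girl-gets-better {b} {y} {g} Jb≡g M₁y≡g with join-cases M₁ M₂ b
    ... | inj₁ (Jb≡M₂b , _) = ≮⇒≥ y-blocks
      where
      y-blocks : ¬ (gp g y < gp g b)
      y-blocks g-prefers-y = y≢b (join-injective (trans Jy≡M₁y (trans M₁y≡g (sym Jb≡g))))
        where
        y≢b : y ≢ b
        y≢b refl = <-irrefl refl g-prefers-y
        y-ge : bp y (M₂ y) ≤ bp y (M₁ y)
        y-ge = ≮⇒≥ λ lt → no-blocking-pair M₂-stable (trans (sym Jb≡M₂b) Jb≡g)
                 (subst (λ g → bp y g < bp y (M₂ y)) M₁y≡g lt) g-prefers-y
        Jy≡M₁y : join M₁ M₂ y ≡ M₁ y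
        Jy≡M₁y = join-≥ M₁ M₂ y y-ge
    ... | inj₂ (Jb≡M₁b , _) with M-injective M₁-stable {y} {b} (trans M₁y≡g (trans (sym Jb≡g) Jb≡M₁b))
    ... | refl = ≤-refl

  join-girl-gets-betterʳ : ∀ {M₁ M₂} → Stable M₁ → Stable M₂ →
                           ∀ {b y g} → join M₁ M₂ b ≡ g → M₂ y ≡ g → gp g b ≤ gp g y
  join-girl-gets-betterʳ {M₁} {M₂} M₁-stable M₂-stable {b} Jb≡g =
    Join.girl-gets-better M₂-stable M₁-stable (trans (join-comm M₂ M₁ b) Jb≡g)

  join-stable : ∀ {M₁ M₂} → Stable M₁ → Stable M₂ → Stable (join M₁ M₂)
  join-stable {M₁} {M₂} M₁-stable M₂-stable = Join.join-injective M₁-stable M₂-stable , no-blocking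
    where
    no-blocking : ∀ b b′ → bp b (join M₁ M₂ b′) < bp b (join M₁ M₂ b) →
                  ¬ (gp (join M₁ M₂ b′) b < gp (join M₁ M₂ b′) b′)
    no-blocking b b′ b-prefers g-prefers with join-cases M₁ M₂ b
    ... | inj₁ (Jb≡M₂b , _) =
      no-blocking-pair M₂-stable (partner-matched M₂-stable _)
        (subst (λ h → bp b (join M₁ M₂ b′) < bp b h) Jb≡M₂b b-prefers)
        (<-≤-trans g-prefers (join-girl-gets-betterʳ M₁-stable M₂-stable refl (partner-matched M₂-stable _)))
    ... | inj₂ (Jb≡M₁b , _) =
      no-blocking-pair M₁-stable (partner-matched M₁-stable _)
        (subst (λ h → bp b (join M₁ M₂ b′) < bp b h) Jb≡M₁b b-prefers)
        (<-≤-trans g-prefers (Join.girl-gets-better M₁-stable M₂-stable refl (partner-matched M₁-stable _)))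

  dominated-better-for-girls : ∀ {M M′} → Stable M′ → Dominates M M′ →
                               ∀ {x y g} → M x ≡ g → M′ y ≡ g → gp g y ≤ gp g x
  dominated-better-for-girls {M′ = M′} M′-stable dominates {x} {y} {g} Mx≡g M′y≡g = ≮⇒≥ x-blocks
    where
    x-blocks : ¬ (gp g x < gp g y)
    x-blocks g-prefers-x = no-blocking-pair M′-stable M′y≡g x-prefers-g g-prefers-x
      where
      g≢M′x : g ≢ M′ x
      g≢M′x g≡M′x with M-injective M′-stable {x} {y} (trans (sym g≡M′x) (sym M′y≡g))
      ... | refl = <-irrefl refl g-prefers-x
      x-prefers-g : bp x g < bp x (M′ x)
      x-prefers-g = bp-< x (subst (λ h → bp x h ≤ bp x (M′ x)) Mx≡g (dominates x)) g≢M′x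

  s-bound-dominated : ∀ {M M′} → Stable M′ → Dominates M M′ →
                      ∀ {b h} → IsS M b h → M′ b ≢ M b → bp b h ≤ bp b (M′ b)
  s-bound-dominated {M} {M′} M′-stable dominates {b} (_ , h-first) M′b≢Mb =
    ≮⇒≥ λ lt → h-first (M′ b) lt girl-prefers-b
    where
    girl-prefers-b : GPrefers M (M′ b) b
    girl-prefers-b x Mx≡M′b = gp-< (M′ b) (dominated-better-for-girls M′-stable dominates Mx≡M′b refl) b≢x
      where
      b≢x : b ≢ x
      b≢x refl = M′b≢Mb (sym Mx≡M′b)

  s-bound : ∀ {M M′} → Stable M → Stable M′ →
            ∀ {b h} → IsS M b h → bp b (M b) < bp b (M′ b) → bp b h ≤ bp b (M′ b)
  s-bound {M} {M′} M-stable M′-stable {b} {h} s lt =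
    subst (λ g → bp b h ≤ bp b g) J≡M′
      (s-bound-dominated (join-stable M-stable M′-stable) (join-dominatesˡ M M′) s J≢M)
    where
    J≡M′ : join M M′ b ≡ M′ b
    J≡M′ = join-≤ M M′ b (<⇒≤ lt)
    J≢M : join M M′ b ≢ M b
    J≢M J≡M = <-irrefl (cong (bp b) (trans (sym J≡M) J≡M′)) lt

  dominated-agrees-on-rotation : ∀ {M M′} ρ → Stable M′ → Dominates M M′ → ExposedIn M ρ →
    ∀ {x y} → Moved ρ x → M′ x ≡ M x → Moved ρ y → M′ y ≡ M y
  dominated-agrees-on-rotation {M} {M′} ρ M′-stable dominates exposed {y = b} x-moved agrees b-moved
    with M′ b ≟ M b
  ... | yes agrees-b = agrees-b
  ... | no disagrees-b = contradiction agrees (around-cycle _ disagreement-spreads b-moved disagrees-b x-moved)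
    where
    open Cycle M ρ exposed
    disagreement-spreads : ∀ k → M′ (boy k) ≢ M (boy k) → M′ (boy (csuc k)) ≢ M (boy (csuc k))
    disagreement-spreads k disagrees agrees = no-blocking-pair M′-stable agrees x-prefers (proj₁ (boy-next k) y refl)
      where
      x y : Boy
      x = boy k
      y = boy (csuc k)
      M′x≢My : M′ x ≢ M y
      M′x≢My eq with M-injective M′-stable {x} {y} (trans eq (sym agrees))
      ... | x≡y = disagrees (trans eq (cong M (sym x≡y)))
      x-prefers : bp x (M y) < bp x (M′ x)
      x-prefers = bp-< x (s-bound-dominated M′-stable dominates (boy-next k) disagrees) (M′x≢My ∘ sym)

  s-bounded-by-move : ∀ {M₁ M₂} ρ₂ → Stable M₁ → Stable M₂ → ExposedIn M₂ ρ₂ →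
                      ∀ {x h₁ h₂} → IsS M₁ x h₁ → lookup ρ₂ x ≡ just (M₁ x , h₂) →
                      bp x h₁ ≤ bp x h₂
  s-bounded-by-move {M₁} {M₂} ρ₂ M₁-stable M₂-stable exposed₂ {x} {h₁} s₁ moved₂
    with Cycle.moves-from-partner-to-s M₂ ρ₂ exposed₂ moved₂
  ... | M₁x≡M₂x , s₂ =
    subst (λ g → bp x h₁ ≤ bp x g) (elim-moved M₂ ρ₂ x moved₂)
      (s-bound M₁-stable (Elimination.elim-stable M₂ ρ₂ M₂-stable exposed₂) s₁
        (subst (λ g → bp x g < bp x (elim M₂ ρ₂ x)) (sym M₁x≡M₂x)
          (subst (λ g → bp x (M₂ x) < bp x g) (sym (elim-moved M₂ ρ₂ x moved₂)) (s-worse M₂-stable s₂))))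

  module Overlap (M₁ M₂ : Matching) (ρ₁ ρ₂ : Rot) (M₁-stable : Stable M₁) (M₂-stable : Stable M₂)
                 (exposed₁ : ExposedIn M₁ ρ₁) (exposed₂ : ExposedIn M₂ ρ₂) where

    module C₁ = Cycle M₁ ρ₁ exposed₁
    module C₂ = Cycle M₂ ρ₂ exposed₂

    SameSource : Boy → Set
    SameSource x = ∃ λ a → MovesFrom ρ₁ x a × MovesFrom ρ₂ x a

    same-target : ∀ {x a c₁ c₂} → lookup ρ₁ x ≡ just (a , c₁) → lookup ρ₂ x ≡ just (a , c₂) →
                  c₁ ≡ c₂
    same-target {x} moved₁ moved₂ with C₁.moves-from-partner-to-s moved₁ | C₂.moves-from-partner-to-s moved₂
    ... | refl , s₁ | a≡M₂x , s₂ = bp-injective x (≤-antisym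
      (s-bounded-by-move ρ₂ M₁-stable M₂-stable exposed₂ s₁ moved₂)
      (s-bounded-by-move ρ₁ M₂-stable M₁-stable exposed₁ s₂
        (subst (λ a → lookup ρ₁ x ≡ just (a , _)) a≡M₂x moved₁)))

    successors-coincide : ∀ {x a c y₁ y₂ c₁ c₂} →
      lookup ρ₁ x ≡ just (a , c) → lookup ρ₂ x ≡ just (a , c) →
      lookup ρ₁ y₁ ≡ just (c , c₁) → lookup ρ₂ y₂ ≡ just (c , c₂) → y₁ ≡ y₂
    successors-coincide {x} {y₁ = y₁} {y₂} moved₁ moved₂ moved₁-y₁ moved₂-y₂ =
      Join.join-injective M₁-stable M₂-stable (trans agrees₁ (trans M₁y₁≡M₂y₂ (sym agrees₂)))
      where
      J-stable : Stable (join M₁ M₂)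
      J-stable = join-stable M₁-stable M₂-stable
      M₁x≡M₂x : M₁ x ≡ M₂ x
      M₁x≡M₂x = trans (sym (proj₁ (C₁.moves-from-partner-to-s moved₁)))
                      (proj₁ (C₂.moves-from-partner-to-s moved₂))
      J≡M₂ : join M₁ M₂ x ≡ M₂ x
      J≡M₂ = join-≤ M₁ M₂ x (≤-reflexive (cong (bp x) M₁x≡M₂x))
      agrees₁ : join M₁ M₂ y₁ ≡ M₁ y₁
      agrees₁ = dominated-agrees-on-rotation ρ₁ J-stable (join-dominatesˡ M₁ M₂) exposed₁
                  (_ , moved₁) (trans J≡M₂ (sym M₁x≡M₂x)) (_ , moved₁-y₁)
      agrees₂ : join M₁ M₂ y₂ ≡ M₂ y₂
      agrees₂ = dominated-agrees-on-rotation ρ₂ J-stable (join-dominatesʳ M₁ M₂) exposed₂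
                  (_ , moved₂) J≡M₂ (_ , moved₂-y₂)
      M₁y₁≡M₂y₂ : M₁ y₁ ≡ M₂ y₂
      M₁y₁≡M₂y₂ = trans (sym (proj₁ (C₁.moves-from-partner-to-s moved₁-y₁)))
                        (proj₁ (C₂.moves-from-partner-to-s moved₂-y₂))

    same-source-spreads : ∀ {x y} → lookup ρ₁ x ≡ just (M₁ x , M₁ y) → SameSource x → SameSource y
    same-source-spreads {x} {y} moved₁ (a , (c₁ , moved₁′) , (c₂ , moved₂))
      with just-injective (trans (sym moved₁) moved₁′)
    ... | refl with same-target moved₁ moved₂
    ... | refl with C₁.successor moved₁ | C₂.successor moved₂
    ... | y₁ , _ , moved₁-y₁ | y₂ , _ , moved₂-y₂
      with M-injective M₁-stable {y} {y₁} (proj₁ (C₁.moves-from-partner-to-s moved₁-y₁))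
         | successors-coincide moved₁ moved₂ moved₁-y₁ moved₂-y₂
    ... | refl | refl = M₁ y , (_ , moved₁-y₁) , (_ , moved₂-y₂)

    same-source-on-rotation : ∀ {x y} → SameSource x → Moved ρ₁ y → SameSource y
    same-source-on-rotation x-same@(_ , (_ , moved₁) , _) =
      C₁.around-cycle SameSource (λ i → same-source-spreads (C₁.boy-moves i)) (_ , moved₁) x-same

  rotation-unique-from : ∀ {ρ₁ ρ₂ b g} → IsRot ρ₁ → IsRot ρ₂ →
                         MovesFrom ρ₁ b g → MovesFrom ρ₂ b g → ρ₁ ≡ ρ₂
  rotation-unique-from {ρ₁} {ρ₂} {g = g} (M₁ , M₁-stable , exposed₁) (M₂ , M₂-stable , exposed₂)
                       from₁ from₂ =
    trans (sym (tabulate∘lookup ρ₁)) (trans (tabulate-cong same-lookup) (tabulate∘lookup ρ₂))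
    where
    module O₁₂ = Overlap M₁ M₂ ρ₁ ρ₂ M₁-stable M₂-stable exposed₁ exposed₂
    module O₂₁ = Overlap M₂ M₁ ρ₂ ρ₁ M₂-stable M₁-stable exposed₂ exposed₁
    same-lookup : ∀ x → lookup ρ₁ x ≡ lookup ρ₂ x
    same-lookup x with moved-or-fixed ρ₁ x | moved-or-fixed ρ₂ x
    same-lookup x | inj₁ (_ , _ , moved₁) | _ with O₁₂.same-source-on-rotation (g , from₁ , from₂) (_ , moved₁)
    ... | _ , (_ , l₁) , (_ , l₂) =
      trans l₁ (trans (cong (λ c → just (_ , c)) (O₁₂.same-target l₁ l₂)) (sym l₂))
    same-lookup x | inj₂ fixed₁ | inj₁ (_ , _ , moved₂)
      with O₂₁.same-source-on-rotation (g , from₂ , from₁) (_ , moved₂)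
    ... | _ , _ , (_ , l₁) = contradiction (trans (sym fixed₁) l₁) λ ()
    same-lookup x | inj₂ fixed₁ | inj₂ fixed₂ = trans fixed₁ (sym fixed₂)

  rotation-unique-to : ∀ {ρ₁ ρ₂ b g} → IsRot ρ₁ → IsRot ρ₂ →
                       MovesTo ρ₁ b g → MovesTo ρ₂ b g → ρ₁ ≡ ρ₂
  rotation-unique-to {ρ₁} {ρ₂} {b} {g} rot₁@(M₁ , M₁-stable , exposed₁) rot₂@(M₂ , M₂-stable , exposed₂)
                     (_ , to₁) (_ , to₂)
    with Cycle.moves-from-partner-to-s M₁ ρ₁ exposed₁ to₁ | Cycle.moves-from-partner-to-s M₂ ρ₂ exposed₂ to₂
  ... | refl , s₁ | refl , s₂ =
    rotation-unique-from rot₁ rot₂ (g , to₁)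
      (g , subst (λ a → lookup ρ₂ b ≡ just (a , g)) (sym M₁b≡M₂b) to₂)
    where
    not-better : ∀ {M M′} → Stable M → Stable M′ → IsS M b g → IsS M′ b g → ¬ (bp b (M b) < bp b (M′ b))
    not-better M-stable M′-stable s s′ lt = <⇒≱ (s-worse M′-stable s′) (s-bound M-stable M′-stable s lt)
    M₁b≡M₂b : M₁ b ≡ M₂ b
    M₁b≡M₂b = bp-injective b (≤-antisym (≮⇒≥ (not-better M₂-stable M₁-stable s₂ s₁))
                                        (≮⇒≥ (not-better M₁-stable M₂-stable s₁ s₂)))

  eliminated-is-rotation : ∀ {M ρs ρ} → ElimSeq M ρs → ρ ∈ ρs → IsRot ρ
  eliminated-is-rotation (step {M = N} _ N-stable exposed) (here refl) = N , N-stable , exposed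
  eliminated-is-rotation (step seq _ _) (there ρ∈ρs) = eliminated-is-rotation seq ρ∈ρs

  eliminated-stable : Stable M0 → ∀ {M ρs} → ElimSeq M ρs → Stable M
  eliminated-stable M0-stable start = M0-stable
  eliminated-stable _ (step {M = N} {ρ = ρ} _ N-stable exposed) = Elimination.elim-stable N ρ N-stable exposed

  elim-dominated : ∀ M ρ → Stable M → ExposedIn M ρ → Dominates M (elim M ρ)
  elim-dominated M ρ M-stable exposed b with moved-or-fixed ρ b
  ... | inj₂ fixed = ≤-reflexive (cong (bp b) (sym (elim-fixed M ρ b fixed)))
  ... | inj₁ (_ , _ , moved) = subst (λ g → bp b (M b) ≤ bp b g) (sym (elim-moved M ρ b moved))
          (<⇒≤ (s-worse M-stable (proj₂ (Cycle.moves-from-partner-to-s M ρ exposed moved))))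

  eliminated-move-bounds : ∀ {M ρs ρ b a c} → ElimSeq M ρs → ρ ∈ ρs → lookup ρ b ≡ just (a , c) →
                           bp b a < bp b c × bp b c ≤ bp b (M b)
  eliminated-move-bounds {b = b} (step {M = N} {ρ = ρ} _ N-stable exposed) (here refl) moved
    with Cycle.moves-from-partner-to-s N ρ exposed moved
  ... | refl , s = s-worse N-stable s , ≤-reflexive (cong (bp b) (sym (elim-moved N ρ b moved)))
  eliminated-move-bounds {b = b} (step {M = N} {ρ = ρ} seq N-stable exposed) (there ρ∈ρs) moved =
    map₂ (λ le → ≤-trans le (elim-dominated N ρ N-stable exposed b)) (eliminated-move-bounds seq ρ∈ρs moved)

  last-move : ∀ {M ρs} b → ElimSeq M ρs → M b ≢ M0 b → ∃ λ ρ → ρ ∈ ρs × MovesTo ρ b (M b)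
  last-move b start moved = contradiction refl moved
  last-move b (step {M = N} {ρ = ρ} seq _ _) moved with moved-or-fixed ρ b
  ... | inj₁ (a , _ , ρ-moves) =
    ρ , here refl , a , subst (λ g → lookup ρ b ≡ just (a , g)) (sym (elim-moved N ρ b ρ-moves)) ρ-moves
  ... | inj₂ fixed with last-move b seq (moved ∘ trans (elim-fixed N ρ b fixed))
  ... | ρ′ , ρ′∈ρs , a , to =
    ρ′ , there ρ′∈ρs , a , subst (λ g → lookup ρ′ b ≡ just (a , g)) (sym (elim-fixed N ρ b fixed)) to

  Reached : List Rot → Boy → Girl → Set
  Reached ρs b g = M0 b ≡ g ⊎ ∃ λ ρ → ρ ∈ ρs × MovesTo ρ b g

  reached-before-step : ∀ N {ρ ρs b g} → Reached (ρ ∷ ρs) b g → elim N ρ b ≢ g → Reached ρs b g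
  reached-before-step N (inj₁ M0b≡g) _ = inj₁ M0b≡g
  reached-before-step N {b = b} (inj₂ (ρ , here refl , _ , to)) elim≢g = contradiction (elim-moved N ρ b to) elim≢g
  reached-before-step N (inj₂ (ρ′ , there ρ′∈ρs , to)) _ = inj₂ (ρ′ , ρ′∈ρs , to)

  left-behind : ∀ {M ρs b g} → ElimSeq M ρs → Reached ρs b g → M b ≢ g →
                ∃ λ ρ → ρ ∈ ρs × MovesFrom ρ b g
  left-behind start (inj₁ M0b≡g) M0b≢g = contradiction M0b≡g M0b≢g
  left-behind start (inj₂ (_ , () , _)) _
  left-behind {b = b} {g} (step {M = N} {ρ = ρ} seq _ exposed) reached Mb≢g with N b ≟ g
  ... | no Nb≢g with left-behind seq (reached-before-step N reached Mb≢g) Nb≢g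
  ...   | ρ′ , ρ′∈ρs , from = ρ′ , there ρ′∈ρs , from
  left-behind {b = b} {g} (step {M = N} {ρ = ρ} seq _ exposed) reached Mb≢g | yes Nb≡g with moved-or-fixed ρ b
  ... | inj₂ fixed = contradiction (trans (elim-fixed N ρ b fixed) Nb≡g) Mb≢g
  ... | inj₁ (a , c , moved) = ρ , here refl , c ,
    subst (λ a → lookup ρ b ≡ just (a , c))
      (trans (proj₁ (Cycle.moves-from-partner-to-s N ρ exposed moved)) Nb≡g) moved

  module _ {M ρs} (seq : ElimSeq M ρs) where

    stays⇔not-left : ∀ {b g ρ} → Reached ρs b g → IsRot ρ → MovesFrom ρ b g → ρ ∉ ρs ⇔ M b ≡ g
    stays⇔not-left {b} {g} {ρ} reached ρ-rot (c , from) = mk⇔ stays not-left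
      where
      stays : ρ ∉ ρs → M b ≡ g
      stays ρ∉ρs with M b ≟ g
      ... | yes Mb≡g = Mb≡g
      ... | no Mb≢g with left-behind seq reached Mb≢g
      ... | ρ′ , ρ′∈ρs , from′ = contradiction (subst (_∈ ρs) ρ′≡ρ ρ′∈ρs) ρ∉ρs
        where
        ρ′≡ρ : ρ′ ≡ ρ
        ρ′≡ρ = rotation-unique-from (eliminated-is-rotation seq ρ′∈ρs) ρ-rot from′ (c , from)
      not-left : M b ≡ g → ρ ∉ ρs
      not-left Mb≡g ρ∈ρs with eliminated-move-bounds seq ρ∈ρs from
      ... | g<c , c≤Mb = <⇒≱ g<c (≤-trans c≤Mb (≤-reflexive (cong (bp b) Mb≡g)))

    reached-by : ∀ {b g ρ} → M0 b ≢ g → IsRot ρ → MovesTo ρ b g → M b ≡ g → ρ ∈ ρs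
    reached-by {b} M0b≢g ρ-rot to refl with last-move b seq (M0b≢g ∘ sym)
    ... | ρ′ , ρ′∈ρs , to′ =
      subst (_∈ ρs) (rotation-unique-to (eliminated-is-rotation seq ρ′∈ρs) ρ-rot to′ to) ρ′∈ρs

    reached-last : Stable M0 → BoyPessimal Mz →
                   ∀ {b g ρ} → Mz b ≡ g → ρ ∈ ρs → MovesTo ρ b g → M b ≡ g
    reached-last M0-stable Mz-pessimal {b} refl ρ∈ρs (_ , to) = bp-injective b (≤-antisym
      (Mz-pessimal M (eliminated-stable M0-stable seq) b)
      (proj₂ (eliminated-move-bounds seq ρ∈ρs to)))

  module _ {S : Vtx → Bool} (closed : ∀ u w → Edge u w → S u ≡ false → S w ≡ false) where

    outside-closed : ∀ {u w} → S u ≡ false → Path u w → S w ≡ false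
    outside-closed Su≡false [] = Su≡false
    outside-closed Su≡false (e ∷ P) = outside-closed (closed _ _ e Su≡false) P

    crossing⇔endpoints : ∀ {u w} (P : Path u w) → HasCrossing S P ⇔ (S u ≡ true × S w ≡ false)
    crossing⇔endpoints P = mk⇔ (crossing-endpoints P) (uncurry (endpoints-crossing P))
      where
      crossing-endpoints : ∀ {u w} (P : Path u w) → HasCrossing S P → S u ≡ true × S w ≡ false
      crossing-endpoints (e ∷ P) (inj₁ (Su≡true , Sv≡false)) = Su≡true , outside-closed Sv≡false P
      crossing-endpoints (e ∷ P) (inj₂ crossing) with crossing-endpoints P crossing
      ... | Sv≡true , Sw≡false = ¬-not (λ Su≡false → not-¬ (closed _ _ e Su≡false) Sv≡true) , Sw≡false
      endpoints-crossing : ∀ {u w} (P : Path u w) → S u ≡ true → S w ≡ false → HasCrossing S P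
      endpoints-crossing [] Su≡true Su≡false = contradiction (trans (sym Su≡true) Su≡false) λ ()
      endpoints-crossing (_∷_ {w = v} e P) Su≡true Sw≡false with S v in Sv
      ... | false = inj₁ (Su≡true , refl)
      ... | true = inj₂ (endpoints-crossing P Sv Sw≡false)

  endpoints⇔partner : Stable M0 → BoyPessimal Mz → ∀ {S} → IdealCut S →
    ∀ {M} → GeneratedBy (λ ρ → IsRot ρ × S (rot ρ) ≡ true) M →
    ∀ {b g u w} → PEnds b g u w → (S u ≡ true × S w ≡ false) ⇔ M b ≡ g
  endpoints⇔partner M0-stable Mz-pessimal {S} (src-in , snk-out , _) {M} (ρs , seq , ∈⇔C) = by-ends
    where
    open Equivalence
    in-cut : ∀ {ρ} → IsRot ρ → S (rot ρ) ≡ true ⇔ ρ ∈ ρs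
    in-cut {ρ} ρ-rot = mk⇔ (λ ρ-in → from (∈⇔C ρ) (ρ-rot , ρ-in)) (proj₂ ∘ to (∈⇔C ρ))
    out-of-cut : ∀ {ρ} → IsRot ρ → S (rot ρ) ≡ false ⇔ ρ ∉ ρs
    out-of-cut ρ-rot = mk⇔ (λ ρ-out → not-¬ ρ-out ∘ from (in-cut ρ-rot))
                           (λ ρ∉ρs → ¬-not (ρ∉ρs ∘ to (in-cut ρ-rot)))
    by-ends : ∀ {b g u w} → PEnds b g u w → (S u ≡ true × S w ≡ false) ⇔ M b ≡ g
    by-ends {b} {g} (inM0 {ρ} M0b≡g ρ-rot moves-from) = mk⇔
      (λ (_ , ρ-out) → to stays (to (out-of-cut ρ-rot) ρ-out))
      (λ Mb≡g → src-in , from (out-of-cut ρ-rot) (from stays Mb≡g))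
      where
      stays : ρ ∉ ρs ⇔ M b ≡ g
      stays = stays⇔not-left seq (inj₁ M0b≡g) ρ-rot moves-from
    by-ends (inMz M0b≢g Mzb≡g ρ-rot moves-to) = mk⇔
      (λ (ρ-in , _) → reached-last seq M0-stable Mz-pessimal Mzb≡g (to (in-cut ρ-rot) ρ-in) moves-to)
      (λ Mb≡g → from (in-cut ρ-rot) (reached-by seq M0b≢g ρ-rot moves-to Mb≡g) , snk-out)
    by-ends {b} {g} (inner {ρ} {ρ′} M0b≢g _ ρ-rot ρ′-rot moves-to moves-from) = mk⇔
      (λ (ρ-in , ρ′-out) → to (stays (to (in-cut ρ-rot) ρ-in)) (to (out-of-cut ρ′-rot) ρ′-out))
      (λ Mb≡g → let ρ∈ρs = reached-by seq M0b≢g ρ-rot moves-to Mb≡g in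
                from (in-cut ρ-rot) ρ∈ρs , from (out-of-cut ρ′-rot) (from (stays ρ∈ρs) Mb≡g))
      where
      stays : ρ ∈ ρs → ρ′ ∉ ρs ⇔ M b ≡ g
      stays ρ∈ρs = stays⇔not-left seq (inj₂ (ρ , ρ∈ρs , moves-to)) ρ′-rot moves-from

lemma9 : (n : ℕ) (bp gp : Fin n → Fin n → ℕ) →
    (∀ b → Injective _≡_ _≡_ (bp b)) → (∀ g → Injective _≡_ _≡_ (gp g)) →
    (M0 Mz : Fin n → Fin n) →
    let open Inst n bp gp M0 Mz in
    Stable M0 → BoyOptimal M0 → Stable Mz → BoyPessimal Mz →
    (S : Vtx → Bool) → IdealCut S →
    (M : Matching) → GeneratedBy (λ ρ → IsRot ρ × S (rot ρ) ≡ true) M →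
    ∀ b g → OccursSomeNotAll b g →
    ∀ u w → PEnds b g u w → (P : Path u w) →
    (HasCrossing S P ⇔ M b ≡ g)
lemma9 n bp gp bp-injective gp-injective M0 Mz M0-stable _ _ Mz-pessimal S cut M generated b g _ u w ends P =
  ⇔-trans (crossing⇔endpoints (proj₂ (proj₂ cut)) P) (endpoints⇔partner M0-stable Mz-pessimal cut generated ends)
  where open Matchings n bp gp bp-injective gp-injective M0 Mz
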